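{- Let $\{A,B,D\}$ be a collection of three distinct finite sets all of the same positive cardinality. Then $\{A,B,D\}$ is an hke collection if and only if $|A\cap D-B|=|B-A-D|$.
   Context: A collection $F$ of finite sets is an \emph{hke collection} if there is a positive integer $\alpha$ such that $|\bigcup \Gamma|+|\bigcap \Gamma|=2\alpha$ for every non-empty subcollection $\Gamma\subseteq F$. $X-Y$ denotes set difference; $A\cap D-B=(A\cap D)-B$ and $B-A-D=(B-A)-D$. -}

module Defs where

open import Data.Nat using (ℕ; _+_; _*_; _<_)
open import Data.Bool using (Bool; true; false)
open import Data.Vec using (Vec; []; _∷_)
open import Data.List using (List; []; _∷_)
open import Data.Product using (Σ; _×_; ∃)
open import Relation.Binary.PropositionalEquality using (_≡_)
open import Data.Fin.Subset using (Subset; ⋃; ⋂; ∣_∣; Nonempty)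

selected : ∀ {n k} → Vec (Subset n) k → Subset k → List (Subset n)
selected [] [] = []
selected (X ∷ F) (true ∷ Γ) = X ∷ selected F Γ
selected (X ∷ F) (false ∷ Γ) = selected F Γ

-- F (a collection of finite sets, all subsets of a common finite universe Fin n,
-- listed without repetition) is hke iff there is a positive α with
-- |⋃Γ| + |⋂Γ| = 2α for every non-empty subcollection Γ.
IsHke : ∀ {n k} → Vec (Subset n) k → Set
IsHke {n} {k} F =
  Σ ℕ λ α → (0 < α) ×
    ((Γ : Subset k) → Nonempty Γ →
       ∣ ⋃ (selected F Γ) ∣ + ∣ ⋂ (selected F Γ) ∣ ≡ 2 * α)

-- Splitting A ∪ B ∪ D = (A ∪ D) ⊎ (B ─ A ─ D) and A ∩ D = (A ∩ B ∩ D) ⊎ (A ∩ D ─ B), the modular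
-- law |A ∪ D| + |A ∩ D| = |A| + |D| gives
--   |⋃{A,B,D}| + |⋂{A,B,D}| + |A ∩ D ─ B| = |A| + |D| + |B ─ A ─ D|.
-- For sets of a common size a every proper subcollection already has |⋃| + |⋂| = 2a, so the
-- collection is hke iff the whole of it has, i.e. iff |A ∩ D ─ B| = |B ─ A ─ D|.
module Submission where

open import Defs
open import Data.Nat using (ℕ; suc; _+_; _*_; _<_)
open import Data.Nat.Properties using (+-suc; +-assoc; +-comm; +-identityʳ; +-cancelˡ-≡; +-cancelʳ-≡)
open import Data.Nat.Tactic.RingSolver using (solve-∀)
open import Data.Product using (_,_)
open import Data.List using (List; []; _∷_)
open import Data.Vec using (Vec; []; _∷_; here)
open import Data.Fin using (zero)
open import Data.Fin.Subset using (Subset; inside; outside; ⊥; ⊤; ∣_∣; _∩_; _∪_; _─_; ⋃; ⋂; Nonempty)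
open import Data.Fin.Subset.Properties using (∉⊥; ∪-assoc; ∪-comm; ∪-identityʳ; ∩-assoc; ∩-comm; ∩-identityʳ)
open import Data.Empty using (⊥-elim)
open import Relation.Binary.PropositionalEquality using (_≡_; _≢_; refl; sym; trans; cong; cong₂; module ≡-Reasoning)
open import Function.Bundles using (_⇔_; mk⇔)

private
  variable
    n : ℕ

∣p∣≡∣p∩q∣+∣p─q∣ : (p q : Subset n) → ∣ p ∣ ≡ ∣ p ∩ q ∣ + ∣ p ─ q ∣
∣p∣≡∣p∩q∣+∣p─q∣ []            []            = refl
∣p∣≡∣p∩q∣+∣p─q∣ (inside  ∷ p) (inside  ∷ q) = cong suc (∣p∣≡∣p∩q∣+∣p─q∣ p q)
∣p∣≡∣p∩q∣+∣p─q∣ (inside  ∷ p) (outside ∷ q) =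
  trans (cong suc (∣p∣≡∣p∩q∣+∣p─q∣ p q)) (sym (+-suc ∣ p ∩ q ∣ ∣ p ─ q ∣))
∣p∣≡∣p∩q∣+∣p─q∣ (outside ∷ p) (inside  ∷ q) = ∣p∣≡∣p∩q∣+∣p─q∣ p q
∣p∣≡∣p∩q∣+∣p─q∣ (outside ∷ p) (outside ∷ q) = ∣p∣≡∣p∩q∣+∣p─q∣ p q

∣p∪q∣≡∣p∣+∣q─p∣ : (p q : Subset n) → ∣ p ∪ q ∣ ≡ ∣ p ∣ + ∣ q ─ p ∣
∣p∪q∣≡∣p∣+∣q─p∣ []            []            = refl
∣p∪q∣≡∣p∣+∣q─p∣ (inside  ∷ p) (_       ∷ q) = cong suc (∣p∪q∣≡∣p∣+∣q─p∣ p q)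
∣p∪q∣≡∣p∣+∣q─p∣ (outside ∷ p) (inside  ∷ q) =
  trans (cong suc (∣p∪q∣≡∣p∣+∣q─p∣ p q)) (sym (+-suc ∣ p ∣ ∣ q ─ p ∣))
∣p∪q∣≡∣p∣+∣q─p∣ (outside ∷ p) (outside ∷ q) = ∣p∪q∣≡∣p∣+∣q─p∣ p q

∣p∪q∣+∣p∩q∣≡∣p∣+∣q∣ : (p q : Subset n) → ∣ p ∪ q ∣ + ∣ p ∩ q ∣ ≡ ∣ p ∣ + ∣ q ∣
∣p∪q∣+∣p∩q∣≡∣p∣+∣q∣ p q = begin
  ∣ p ∪ q ∣ + ∣ p ∩ q ∣              ≡⟨ cong₂ _+_ (∣p∪q∣≡∣p∣+∣q─p∣ p q) (cong ∣_∣ (∩-comm p q)) ⟩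
  ∣ p ∣ + ∣ q ─ p ∣ + ∣ q ∩ p ∣      ≡⟨ +-assoc ∣ p ∣ _ _ ⟩
  ∣ p ∣ + (∣ q ─ p ∣ + ∣ q ∩ p ∣)    ≡⟨ cong (∣ p ∣ +_) (+-comm ∣ q ─ p ∣ _) ⟩
  ∣ p ∣ + (∣ q ∩ p ∣ + ∣ q ─ p ∣)    ≡⟨ cong (∣ p ∣ +_) (sym (∣p∣≡∣p∩q∣+∣p─q∣ q p)) ⟩
  ∣ p ∣ + ∣ q ∣                      ∎
  where open ≡-Reasoning

p─[q∪r]≡p─q─r : (p q r : Subset n) → p ─ (q ∪ r) ≡ p ─ q ─ r
p─[q∪r]≡p─q─r []      []            []            = refl
p─[q∪r]≡p─q─r (x ∷ p) (inside  ∷ q) (inside  ∷ r) = cong (outside ∷_) (p─[q∪r]≡p─q─r p q r)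
p─[q∪r]≡p─q─r (x ∷ p) (inside  ∷ q) (outside ∷ r) = cong (outside ∷_) (p─[q∪r]≡p─q─r p q r)
p─[q∪r]≡p─q─r (x ∷ p) (outside ∷ q) (inside  ∷ r) = cong (outside ∷_) (p─[q∪r]≡p─q─r p q r)
p─[q∪r]≡p─q─r (x ∷ p) (outside ∷ q) (outside ∷ r) = cong (x ∷_) (p─[q∪r]≡p─q─r p q r)

∣p∪q∪r∣+∣p∩q∩r∣+∣p∩r─q∣ : (p q r : Subset n) →
  ∣ p ∪ q ∪ r ∣ + ∣ p ∩ q ∩ r ∣ + ∣ p ∩ r ─ q ∣ ≡ ∣ p ∣ + ∣ r ∣ + ∣ q ─ p ─ r ∣
∣p∪q∪r∣+∣p∩q∩r∣+∣p∩r─q∣ p q r = begin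
  ∣ p ∪ q ∪ r ∣ + ∣ p ∩ q ∩ r ∣ + ∣ p ∩ r ─ q ∣  ≡⟨ cong₂ (λ u i → u + i + ∣ p ∩ r ─ q ∣) union meet ⟩
  ∣ p ∪ r ∣ + ∣ q ─ p ─ r ∣ + ∣ (p ∩ r) ∩ q ∣ + ∣ p ∩ r ─ q ∣
    ≡⟨ rearrange (∣ p ∪ r ∣) (∣ q ─ p ─ r ∣) (∣ (p ∩ r) ∩ q ∣) (∣ p ∩ r ─ q ∣) ⟩
  ∣ p ∪ r ∣ + ((∣ (p ∩ r) ∩ q ∣) + (∣ p ∩ r ─ q ∣)) + ∣ q ─ p ─ r ∣
    ≡⟨ cong (λ i → ∣ p ∪ r ∣ + i + ∣ q ─ p ─ r ∣) (sym (∣p∣≡∣p∩q∣+∣p─q∣ (p ∩ r) q)) ⟩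
  ∣ p ∪ r ∣ + ∣ p ∩ r ∣ + ∣ q ─ p ─ r ∣          ≡⟨ cong (_+ ∣ q ─ p ─ r ∣) (∣p∪q∣+∣p∩q∣≡∣p∣+∣q∣ p r) ⟩
  ∣ p ∣ + ∣ r ∣ + ∣ q ─ p ─ r ∣                  ∎
  where
  open ≡-Reasoning
  union : ∣ p ∪ q ∪ r ∣ ≡ ∣ p ∪ r ∣ + ∣ q ─ p ─ r ∣
  union = begin
    ∣ p ∪ q ∪ r ∣               ≡⟨ cong (λ s → ∣ p ∪ s ∣) (∪-comm q r) ⟩
    ∣ p ∪ r ∪ q ∣               ≡⟨ cong ∣_∣ (sym (∪-assoc p r q)) ⟩
    ∣ (p ∪ r) ∪ q ∣             ≡⟨ ∣p∪q∣≡∣p∣+∣q─p∣ (p ∪ r) q ⟩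
    ∣ p ∪ r ∣ + ∣ q ─ (p ∪ r) ∣ ≡⟨ cong (λ s → ∣ p ∪ r ∣ + ∣ s ∣) (p─[q∪r]≡p─q─r q p r) ⟩
    ∣ p ∪ r ∣ + ∣ q ─ p ─ r ∣   ∎
  meet : ∣ p ∩ q ∩ r ∣ ≡ ∣ (p ∩ r) ∩ q ∣
  meet = cong ∣_∣ (trans (cong (p ∩_) (∩-comm q r)) (sym (∩-assoc p r q)))
  rearrange : ∀ u y i x → u + y + i + x ≡ u + (i + x) + y
  rearrange = solve-∀

∣⋃∣+∣⋂∣ : List (Subset n) → ℕ
∣⋃∣+∣⋂∣ ps = ∣ ⋃ ps ∣ + ∣ ⋂ ps ∣

∣⋃∣+∣⋂∣-[p] : (p : Subset n) → ∣⋃∣+∣⋂∣ (p ∷ []) ≡ ∣ p ∣ + ∣ p ∣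
∣⋃∣+∣⋂∣-[p] p = cong₂ (λ u i → ∣ u ∣ + ∣ i ∣) (∪-identityʳ p) (∩-identityʳ p)

∣⋃∣+∣⋂∣-[p,q] : (p q : Subset n) → ∣⋃∣+∣⋂∣ (p ∷ q ∷ []) ≡ ∣ p ∣ + ∣ q ∣
∣⋃∣+∣⋂∣-[p,q] p q =
  trans (cong₂ (λ u i → ∣ p ∪ u ∣ + ∣ p ∩ i ∣) (∪-identityʳ q) (∩-identityʳ q))
        (∣p∪q∣+∣p∩q∣≡∣p∣+∣q∣ p q)

∣⋃∣+∣⋂∣-[p,q,r] : (p q r : Subset n) →
  ∣⋃∣+∣⋂∣ (p ∷ q ∷ r ∷ []) + ∣ p ∩ r ─ q ∣ ≡ ∣ p ∣ + ∣ r ∣ + ∣ q ─ p ─ r ∣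
∣⋃∣+∣⋂∣-[p,q,r] p q r =
  trans (cong₂ (λ u i → ∣ p ∪ q ∪ u ∣ + ∣ p ∩ q ∩ i ∣ + ∣ p ∩ r ─ q ∣) (∪-identityʳ r) (∩-identityʳ r))
        (∣p∪q∪r∣+∣p∩q∩r∣+∣p∩r─q∣ p q r)

selected-⊥ : ∀ {k} (F : Vec (Subset n) k) → selected F ⊥ ≡ []
selected-⊥ []      = refl
selected-⊥ (_ ∷ F) = selected-⊥ F

-- Testing the hke condition on the one-member subcollection {p} pins down α = |p|.
IsHke⇒∣⋃∣+∣⋂∣≡∣p∣+∣p∣ : ∀ {k} {p : Subset n} {F : Vec (Subset n) k} → IsHke (p ∷ F) →
  (Γ : Subset (suc k)) → Nonempty Γ → ∣⋃∣+∣⋂∣ (selected (p ∷ F) Γ) ≡ ∣ p ∣ + ∣ p ∣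
IsHke⇒∣⋃∣+∣⋂∣≡∣p∣+∣p∣ {p = p} {F} (α , _ , hke) Γ Γ≢∅ = begin
  ∣⋃∣+∣⋂∣ (selected (p ∷ F) Γ)         ≡⟨ hke Γ Γ≢∅ ⟩
  2 * α                                 ≡⟨ sym (hke (inside ∷ ⊥) (zero , here)) ⟩
  ∣⋃∣+∣⋂∣ (p ∷ selected F ⊥)            ≡⟨ cong (λ ps → ∣⋃∣+∣⋂∣ (p ∷ ps)) (selected-⊥ F) ⟩
  ∣⋃∣+∣⋂∣ (p ∷ [])                       ≡⟨ ∣⋃∣+∣⋂∣-[p] p ⟩
  ∣ p ∣ + ∣ p ∣                          ∎
  where open ≡-Reasoning

equalSize-∣⋃∣+∣⋂∣⇒IsHke : {p q r : Subset n} → ∣ p ∣ ≡ ∣ q ∣ → ∣ q ∣ ≡ ∣ r ∣ → 0 < ∣ p ∣ →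
  ∣⋃∣+∣⋂∣ (p ∷ q ∷ r ∷ []) ≡ ∣ p ∣ + ∣ p ∣ → IsHke (p ∷ q ∷ r ∷ [])
equalSize-∣⋃∣+∣⋂∣⇒IsHke {p = p} {q} {r} ∣p∣≡∣q∣ ∣q∣≡∣r∣ 0<∣p∣ full = ∣ p ∣ , 0<∣p∣ , hke
  where
  ∣q∣≡∣p∣ : ∣ q ∣ ≡ ∣ p ∣
  ∣q∣≡∣p∣ = sym ∣p∣≡∣q∣
  ∣r∣≡∣p∣ : ∣ r ∣ ≡ ∣ p ∣
  ∣r∣≡∣p∣ = sym (trans ∣p∣≡∣q∣ ∣q∣≡∣r∣)
  twice : ∀ {x y} → x ≡ ∣ p ∣ → y ≡ ∣ p ∣ → x + y ≡ 2 * ∣ p ∣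
  twice x≡ y≡ = trans (cong₂ _+_ x≡ y≡) (cong (∣ p ∣ +_) (sym (+-identityʳ ∣ p ∣)))
  hke : (Γ : Subset 3) → Nonempty Γ → ∣⋃∣+∣⋂∣ (selected (p ∷ q ∷ r ∷ []) Γ) ≡ 2 * ∣ p ∣
  hke (inside  ∷ inside  ∷ inside  ∷ []) _ = trans full (twice refl refl)
  hke (inside  ∷ inside  ∷ outside ∷ []) _ = trans (∣⋃∣+∣⋂∣-[p,q] p q) (twice refl ∣q∣≡∣p∣)
  hke (inside  ∷ outside ∷ inside  ∷ []) _ = trans (∣⋃∣+∣⋂∣-[p,q] p r) (twice refl ∣r∣≡∣p∣)
  hke (outside ∷ inside  ∷ inside  ∷ []) _ = trans (∣⋃∣+∣⋂∣-[p,q] q r) (twice ∣q∣≡∣p∣ ∣r∣≡∣p∣)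
  hke (inside  ∷ outside ∷ outside ∷ []) _ = trans (∣⋃∣+∣⋂∣-[p] p) (twice refl refl)
  hke (outside ∷ inside  ∷ outside ∷ []) _ = trans (∣⋃∣+∣⋂∣-[p] q) (twice ∣q∣≡∣p∣ ∣q∣≡∣p∣)
  hke (outside ∷ outside ∷ inside  ∷ []) _ = trans (∣⋃∣+∣⋂∣-[p] r) (twice ∣r∣≡∣p∣ ∣r∣≡∣p∣)
  hke (outside ∷ outside ∷ outside ∷ []) (_ , x∈⊥) = ⊥-elim (∉⊥ x∈⊥)

mainTheorem14 : (n : ℕ) (A B D : Subset n) →
    A ≢ B → A ≢ D → B ≢ D →
    ∣ A ∣ ≡ ∣ B ∣ → ∣ B ∣ ≡ ∣ D ∣ → 0 < ∣ A ∣ →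
    IsHke (A ∷ B ∷ D ∷ []) ⇔ (∣ A ∩ D ─ B ∣ ≡ ∣ B ─ A ─ D ∣)
mainTheorem14 _ A B D _ _ _ ∣A∣≡∣B∣ ∣B∣≡∣D∣ 0<∣A∣ = mk⇔ hke⇒X≡Y X≡Y⇒hke
  where
  a X Y : ℕ
  a = ∣ A ∣
  X = ∣ A ∩ D ─ B ∣
  Y = ∣ B ─ A ─ D ∣
  counting : ∣⋃∣+∣⋂∣ (A ∷ B ∷ D ∷ []) + X ≡ a + a + Y
  counting = trans (∣⋃∣+∣⋂∣-[p,q,r] A B D) (cong (λ d → a + d + Y) (sym (trans ∣A∣≡∣B∣ ∣B∣≡∣D∣)))
  hke⇒X≡Y : IsHke (A ∷ B ∷ D ∷ []) → X ≡ Y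
  hke⇒X≡Y hke = +-cancelˡ-≡ (a + a) X Y
    (trans (cong (_+ X) (sym (IsHke⇒∣⋃∣+∣⋂∣≡∣p∣+∣p∣ hke ⊤ (zero , here)))) counting)
  X≡Y⇒hke : X ≡ Y → IsHke (A ∷ B ∷ D ∷ [])
  X≡Y⇒hke X≡Y = equalSize-∣⋃∣+∣⋂∣⇒IsHke ∣A∣≡∣B∣ ∣B∣≡∣D∣ 0<∣A∣
    (+-cancelʳ-≡ X _ _ (trans counting (cong (a + a +_) (sym X≡Y))))
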